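{- Consider tilings of boards by a given set of tile types, some (but not all) of which are designated special, and let $T(n,k)$ be the number of tilings of an $n$-board that use exactly $k$ special tiles, forming a triangle (array) with $(n,k)$-th entry $T(n,k)$. Then: (i) the triangle is a Riordan array if and only if there is a metatile of length $1$ that contains exactly one special tile and there is no metatile that contains more than one special tile; (ii) the triangle is a row-reversed Riordan array if and only if there is a metatile of length $1$ that contains no special tiles and, for every metatile, $l-s\in\{0,1\}$, where $l$ is the length of the metatile and $s$ is the number of special tiles it contains.
   Context: An $n$-board is a linear array of $n$ unit cells. A metatile is a grouping of tiles that completely covers a contiguous block of an integer number of cells (its length) and cannot be split into smaller such groupings; every tiling of a board is uniquely a left-to-right sequence of metatiles. For formal power series $p(x)=p_0+p_1x+\cdots$ and $q(x)=q_1x+q_2x^2+\cdots$, the $(p,q)$ Riordan array is the lower triangular matrix with $(n,k)$-th entry $[x^n]p(x)q(x)^k$ ($n,k\ge0$); an array is a Riordan array if it equals some $(p,q)$ Riordan array. The row-reversed $(p,q)$ Riordan array has $(n,k)$-th entry $[x^n]p(x)q(x)^{n-k}$ for $0\le k\le n$ (each row of the Riordan array reversed up to and including the main diagonal).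
   Formalization: In both parts (i) and (ii), Riordan arrays and row-reversed Riordan arrays have power series p, q with integer coefficients and are required to satisfy p₀ ≠ 0 and q₁ ≠ 0. Apart from conventions, each condition added here is assumed in the paper as well or is needed for the statement above to hold. -}

module Defs where

open import Data.Nat using (ℕ; zero; suc; _+_; _∸_; _≤_; _<_; _≤ᵇ_)
open import Data.Nat.Properties using ()
open import Data.Integer as ℤ using (ℤ; +_)
open import Data.List using (List; []; _∷_; map)
open import Data.Nat.ListAction using (sum)
open import Data.List.Membership.Propositional using (_∈_)
open import Data.Bool using (if_then_else_)
open import Data.Product using (Σ; _×_; ∃₂)
open import Data.Sum using (_⊎_)
open import Relation.Binary.PropositionalEquality using (_≡_; _≢_)

-- A set of metatiles is given by  M : ℕ → List ℕ  where  M l  is the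
-- (finite) list of the special-tile counts of the metatiles of length l,
-- one entry per metatile (so repetitions count distinct metatiles).
-- Metatiles have positive length, so the theorem assumes  M 0 ≡ [].

Metatiles : Set
Metatiles = ℕ → List ℕ

-- Every tiling of an n-board is uniquely a left-to-right sequence of
-- metatiles.  T M n k = number of such sequences of total length n
-- containing exactly k special tiles in total.  It is computed by the
-- decomposition according to the first metatile:
--   T(0,k)   = [k = 0]
--   T(n+1,k) = Σ_{l=1}^{n+1} Σ_{s ∈ M l, s ≤ k} T(n+1-l, k-s).

-- row M n prev k, where prev = [T(n-1), T(n-2), …, T(0)], computes T(n,k).
row : Metatiles → ℕ → List (ℕ → ℕ) → ℕ → ℕ
row M zero    prev k = if k ≤ᵇ 0 then 1 else 0
row M (suc n) prev k = go 1 prev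
  where
  go : ℕ → List (ℕ → ℕ) → ℕ
  go l []       = 0
  go l (r ∷ rs) =
    sum (map (λ s → if s ≤ᵇ k then r (k ∸ s) else 0) (M l)) + go (suc l) rs

table : Metatiles → ℕ → List (ℕ → ℕ)
table M zero    = []
table M (suc n) = row M n (table M n) ∷ table M n

T : Metatiles → ℕ → ℕ → ℕ
T M n = row M n (table M n)

Series : Set
Series = ℕ → ℤ

Σ≤ : ℕ → (ℕ → ℤ) → ℤ
Σ≤ zero    f = f 0
Σ≤ (suc n) f = Σ≤ n f ℤ.+ f (suc n)

_⊛_ : Series → Series → Series
(f ⊛ g) n = Σ≤ n (λ i → f i ℤ.* g (n ∸ i))

oneS : Series
oneS zero    = + 1
oneS (suc _) = + 0

_^S_ : Series → ℕ → Series
f ^S zero  = oneS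
f ^S suc k = f ⊛ (f ^S k)

-- Riordan pair conditions (standard "proper" convention):
-- p₀ ≠ 0, q₀ = 0, q₁ ≠ 0.
RiordanPair : Series → Series → Set
RiordanPair p q = (p 0 ≢ + 0) × (q 0 ≡ + 0) × (q 1 ≢ + 0)

IsRiordan : (ℕ → ℕ → ℕ) → Set
IsRiordan A = ∃₂ λ p q → RiordanPair p q ×
  (∀ n k → + A n k ≡ (p ⊛ (q ^S k)) n)

-- The triangle A is the row-reversed (p,q) Riordan array for some p, q
-- (entries with k > n are those outside the triangle, hence 0).
IsRowReversedRiordan : (ℕ → ℕ → ℕ) → Set
IsRowReversedRiordan A = ∃₂ λ p q → RiordanPair p q ×
  (∀ n k → k ≤ n → + A n k ≡ (p ⊛ (q ^S (n ∸ k))) n) ×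
  (∀ n k → n < k → A n k ≡ 0)

CondI : Metatiles → Set
CondI M = (1 ∈ M 1) × (∀ l s → s ∈ M l → s ≤ 1)

CondII : Metatiles → Set
CondII M = (0 ∈ M 1) × (∀ l s → s ∈ M l → (l ≡ s) ⊎ (l ≡ suc s))

{-# OPTIONS --safe #-}
-- Let W k = Σₙ T(n,k) xⁿ be the column generating functions and C s the generating
-- function, by length, of the metatiles with s special tiles. Splitting off the
-- first metatile gives W k = [k = 0] + Σ_{s ≤ k} C s · W (k - s), which determines
-- the W k because C s (0) = 0. If W k = p qᵏ, comparing with p = W 0 = 1 + C 0 · p
-- gives Σ_{s < k} C (s + 1) · W (k - 1 - s) = qᵏ for k ≥ 1; hence C 1 · p = q, so
-- [x] C 1 = q₁ ≠ 0, and inductively C (s + 2) · p = 0, i.e. C (s + 2) = 0 as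
-- p(0) = 1. Conversely, if C (s + 2) = 0 then p = W 0, q = C 1 · W 0 solve the
-- recursion. Part (ii) is part (i) for the metatiles with special and ordinary
-- cells exchanged: T(n,k) = 0 for k > n forces every metatile to have no more
-- special tiles than cells, and then T(n,k) is the exchanged count at (n, n - k).
module Submission where

open import Defs
open import Data.Bool using (true; false; if_then_else_)
open import Data.Bool.Properties using (if-float)
open import Data.Empty using (⊥-elim)
open import Data.Integer using (ℤ; +_; 0ℤ; 1ℤ; _+_; _*_)
import Data.Integer.Properties as ℤP
open import Algebra.Properties.AbelianGroup ℤP.+-0-abelianGroup using (∙-cancelˡ)
open import Algebra.Properties.CommutativeSemigroup ℤP.+-commutativeSemigroup
  using () renaming (interchange to +-interchange)
open import Data.List using (List; []; _∷_; map)
open import Data.List.Membership.Propositional using (_∈_; _∉_)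
open import Data.List.Membership.Propositional.Properties using (∈-map⁺; ∈-map⁻)
open import Data.List.Properties using (map-∘)
open import Data.List.Relation.Unary.Any using (here; there)
open import Data.List.Relation.Unary.Any.Properties using (¬Any[])
open import Data.Nat as ℕ using (ℕ; zero; suc; _∸_; _≤_; _<_; z≤n; s≤s; _≤ᵇ_; _≟_; _<?_; _≤?_)
import Data.Nat.Properties as ℕP
open import Data.Nat.Induction using (<-rec)
open import Data.Nat.ListAction using (sum)
open import Data.Nat.Tactic.RingSolver using (solve-∀)
open import Data.Product using (_×_; _,_; ∃₂)
open import Data.Product.Function.NonDependent.Propositional using (_×-⇔_)
open import Data.Sum using (_⊎_; inj₁; inj₂)
open import Function.Bundles using (_⇔_; mk⇔)
open import Function.Construct.Composition using (_⇔-∘_)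
open import Function.Related.Propositional using (module EquationalReasoning)
open import Function.Construct.Identity using (⇔-id)
open import Relation.Nullary using (yes; no)
open import Relation.Nullary.Decidable using (proof; dec-true; dec-false)
open import Relation.Nullary.Reflects using (Reflects; ofʸ; ofⁿ)
open import Relation.Binary.PropositionalEquality
  using (_≡_; _≢_; _≗_; refl; sym; trans; cong; cong₂; subst; module ≡-Reasoning)

Σ≤-cong : ∀ n {f g : ℕ → ℤ} → (∀ i → i ≤ n → f i ≡ g i) → Σ≤ n f ≡ Σ≤ n g
Σ≤-cong zero    f≡g = f≡g 0 z≤n
Σ≤-cong (suc n) f≡g =
  cong₂ _+_ (Σ≤-cong n (λ i i≤n → f≡g i (ℕP.m≤n⇒m≤1+n i≤n))) (f≡g (suc n) ℕP.≤-refl)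

Σ≤-zero : ∀ n {f : ℕ → ℤ} → (∀ i → i ≤ n → f i ≡ 0ℤ) → Σ≤ n f ≡ 0ℤ
Σ≤-zero zero    f≡0 = f≡0 0 z≤n
Σ≤-zero (suc n) f≡0 =
  cong₂ _+_ (Σ≤-zero n (λ i i≤n → f≡0 i (ℕP.m≤n⇒m≤1+n i≤n))) (f≡0 (suc n) ℕP.≤-refl)

Σ≤-single : ∀ n x (f : ℕ → ℤ) → x ≤ n → (∀ i → i ≤ n → i ≢ x → f i ≡ 0ℤ) → Σ≤ n f ≡ f x
Σ≤-single zero    zero f z≤n  _   = refl
Σ≤-single (suc n) x    f x≤1+n off with ℕP.m≤n⇒m<n∨m≡n x≤1+n
... | inj₁ x<1+n = trans
  (cong₂ _+_ (Σ≤-single n x f (ℕP.≤-pred x<1+n) (λ i i≤n → off i (ℕP.m≤n⇒m≤1+n i≤n)))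
             (off (suc n) ℕP.≤-refl (λ 1+n≡x → ℕP.<-irrefl (sym 1+n≡x) x<1+n)))
  (ℤP.+-identityʳ (f x))
... | inj₂ refl = trans
  (cong (_+ f (suc n)) (Σ≤-zero n (λ i i≤n → off i (ℕP.m≤n⇒m≤1+n i≤n) (ℕP.<⇒≢ (s≤s i≤n)))))
  (ℤP.+-identityˡ (f (suc n)))

Σ≤-head : ∀ n (f : ℕ → ℤ) → Σ≤ (suc n) f ≡ f 0 + Σ≤ n (λ i → f (suc i))
Σ≤-head zero    f = refl
Σ≤-head (suc n) f = trans (cong (_+ f (suc (suc n))) (Σ≤-head n f)) (ℤP.+-assoc (f 0) _ _)

Σ≤-distrib-+ : ∀ n (f g : ℕ → ℤ) → Σ≤ n (λ i → f i + g i) ≡ Σ≤ n f + Σ≤ n g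
Σ≤-distrib-+ zero    f g = refl
Σ≤-distrib-+ (suc n) f g = trans (cong (_+ (f (suc n) + g (suc n))) (Σ≤-distrib-+ n f g))
  (+-interchange (Σ≤ n f) (Σ≤ n g) (f (suc n)) (g (suc n)))

Σ≤-*ˡ : ∀ n c (f : ℕ → ℤ) → Σ≤ n (λ i → c * f i) ≡ c * Σ≤ n f
Σ≤-*ˡ zero    c f = refl
Σ≤-*ˡ (suc n) c f =
  trans (cong (_+ c * f (suc n)) (Σ≤-*ˡ n c f)) (sym (ℤP.*-distribˡ-+ c (Σ≤ n f) (f (suc n))))

Σ≤-*ʳ : ∀ n c (f : ℕ → ℤ) → Σ≤ n (λ i → f i * c) ≡ Σ≤ n f * c
Σ≤-*ʳ zero    c f = refl
Σ≤-*ʳ (suc n) c f =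
  trans (cong (_+ f (suc n) * c) (Σ≤-*ʳ n c f)) (sym (ℤP.*-distribʳ-+ c (Σ≤ n f) (f (suc n))))

Σ≤-swap : ∀ m n (F : ℕ → ℕ → ℤ) → Σ≤ m (λ i → Σ≤ n (F i)) ≡ Σ≤ n (λ j → Σ≤ m (λ i → F i j))
Σ≤-swap zero    n F = refl
Σ≤-swap (suc m) n F = trans (cong (_+ Σ≤ n (F (suc m))) (Σ≤-swap m n F))
  (sym (Σ≤-distrib-+ n (λ j → Σ≤ m (λ i → F i j)) (F (suc m))))

Σ≤-triangle : ∀ n (F : ℕ → ℕ → ℤ) →
  Σ≤ n (λ m → Σ≤ m (λ i → F i m)) ≡ Σ≤ n (λ i → Σ≤ (n ∸ i) (λ j → F i (i ℕ.+ j)))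
Σ≤-triangle zero    F = refl
Σ≤-triangle (suc n) F = begin
  Σ≤ n (λ m → Σ≤ m (λ i → F i m)) + (Σ≤ n (λ i → F i (suc n)) + F (suc n) (suc n))
    ≡⟨ cong (_+ (Σ≤ n (λ i → F i (suc n)) + F (suc n) (suc n))) (Σ≤-triangle n F) ⟩
  Rows n + (Σ≤ n (λ i → F i (suc n)) + F (suc n) (suc n))
    ≡⟨ sym (ℤP.+-assoc (Rows n) _ _) ⟩
  (Rows n + Σ≤ n (λ i → F i (suc n))) + F (suc n) (suc n)
    ≡⟨ cong₂ _+_ (sym (trans (Σ≤-cong n row-suc) (Σ≤-distrib-+ n _ _))) diagonal ⟩
  Σ≤ n (λ i → Σ≤ (suc n ∸ i) (λ j → F i (i ℕ.+ j)))
    + Σ≤ (suc n ∸ suc n) (λ j → F (suc n) (suc n ℕ.+ j)) ∎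
  where
  open ≡-Reasoning
  Rows : ℕ → ℤ
  Rows m = Σ≤ m (λ i → Σ≤ (m ∸ i) (λ j → F i (i ℕ.+ j)))
  row-suc : ∀ i → i ≤ n →
    Σ≤ (suc n ∸ i) (λ j → F i (i ℕ.+ j)) ≡ Σ≤ (n ∸ i) (λ j → F i (i ℕ.+ j)) + F i (suc n)
  row-suc i i≤n rewrite ℕP.+-∸-assoc 1 i≤n =
    cong (λ t → Σ≤ (n ∸ i) (λ j → F i (i ℕ.+ j)) + t)
         (cong (F i) (trans (ℕP.+-suc i (n ∸ i)) (cong suc (ℕP.m+[n∸m]≡n i≤n))))
  diagonal : F (suc n) (suc n) ≡ Σ≤ (suc n ∸ suc n) (λ j → F (suc n) (suc n ℕ.+ j))
  diagonal rewrite ℕP.n∸n≡0 n | ℕP.+-identityʳ n = refl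

-- Formal power series

⊛-congˡ : ∀ {f f′} → f ≗ f′ → ∀ g → f ⊛ g ≗ f′ ⊛ g
⊛-congˡ f≗f′ g n = Σ≤-cong n (λ i _ → cong (_* g (n ∸ i)) (f≗f′ i))

⊛-congʳ : ∀ f {g g′} → g ≗ g′ → f ⊛ g ≗ f ⊛ g′
⊛-congʳ f g≗g′ n = Σ≤-cong n (λ i _ → cong (f i *_) (g≗g′ (n ∸ i)))

⊛-identityˡ : ∀ f → oneS ⊛ f ≗ f
⊛-identityˡ f n = trans (Σ≤-single n 0 _ z≤n off) (ℤP.*-identityˡ (f n))
  where
  off : ∀ i → i ≤ n → i ≢ 0 → oneS i * f (n ∸ i) ≡ 0ℤ
  off zero    _ i≢0 = ⊥-elim (i≢0 refl)
  off (suc i) _ _   = refl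

⊛-identityʳ : ∀ f → f ⊛ oneS ≗ f
⊛-identityʳ f n = begin
  Σ≤ n (λ i → f i * oneS (n ∸ i)) ≡⟨ Σ≤-single n n _ ℕP.≤-refl off ⟩
  f n * oneS (n ∸ n)               ≡⟨ cong (λ m → f n * oneS m) (ℕP.n∸n≡0 n) ⟩
  f n * 1ℤ                         ≡⟨ ℤP.*-identityʳ (f n) ⟩
  f n                              ∎
  where
  open ≡-Reasoning
  off : ∀ i → i ≤ n → i ≢ n → f i * oneS (n ∸ i) ≡ 0ℤ
  off i i≤n i≢n = trans (cong (λ m → f i * oneS m) (ℕP.+-∸-assoc 1 (ℕP.≤∧≢⇒< i≤n i≢n)))
                        (ℤP.*-zeroʳ (f i))

⊛-distribʳ-+ : ∀ f g h n → ((λ i → f i + g i) ⊛ h) n ≡ (f ⊛ h) n + (g ⊛ h) n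
⊛-distribʳ-+ f g h n =
  trans (Σ≤-cong n (λ i _ → ℤP.*-distribʳ-+ (h (n ∸ i)) (f i) (g i))) (Σ≤-distrib-+ n _ _)

⊛-assoc : ∀ f g h → (f ⊛ g) ⊛ h ≗ f ⊛ (g ⊛ h)
⊛-assoc f g h n = begin
  Σ≤ n (λ m → Σ≤ m (λ i → f i * g (m ∸ i)) * h (n ∸ m))
    ≡⟨ Σ≤-cong n (λ m _ → sym (Σ≤-*ʳ m (h (n ∸ m)) _)) ⟩
  Σ≤ n (λ m → Σ≤ m (λ i → f i * g (m ∸ i) * h (n ∸ m)))
    ≡⟨ Σ≤-triangle n (λ i m → f i * g (m ∸ i) * h (n ∸ m)) ⟩
  Σ≤ n (λ i → Σ≤ (n ∸ i) (λ j → f i * g (i ℕ.+ j ∸ i) * h (n ∸ (i ℕ.+ j))))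
    ≡⟨ Σ≤-cong n (λ i _ → Σ≤-cong (n ∸ i) (λ j _ → reindex i j)) ⟩
  Σ≤ n (λ i → Σ≤ (n ∸ i) (λ j → f i * (g j * h (n ∸ i ∸ j))))
    ≡⟨ Σ≤-cong n (λ i _ → Σ≤-*ˡ (n ∸ i) (f i) _) ⟩
  (f ⊛ (g ⊛ h)) n ∎
  where
  open ≡-Reasoning
  reindex : ∀ i j → f i * g (i ℕ.+ j ∸ i) * h (n ∸ (i ℕ.+ j)) ≡ f i * (g j * h (n ∸ i ∸ j))
  reindex i j = trans
    (cong₂ (λ a b → f i * g a * h b) (ℕP.m+n∸m≡n i j) (sym (ℕP.∸-+-assoc n i j)))
    (ℤP.*-assoc (f i) (g j) (h (n ∸ i ∸ j)))

⊛-zeroˡ : ∀ {f} → (∀ n → f n ≡ 0ℤ) → ∀ g n → (f ⊛ g) n ≡ 0ℤ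
⊛-zeroˡ f≡0 g n = Σ≤-zero n (λ i _ → cong (_* g (n ∸ i)) (f≡0 i))

⊛-suc : ∀ {f} → f 0 ≡ 0ℤ → ∀ g n → (f ⊛ g) (suc n) ≡ Σ≤ n (λ i → f (suc i) * g (n ∸ i))
⊛-suc {f} f₀≡0 g n = trans (Σ≤-head n _)
  (trans (cong (λ c → c * g (suc n) + Σ≤ n (λ i → f (suc i) * g (n ∸ i))) f₀≡0) (ℤP.+-identityˡ _))

⊛-fixpoint : ∀ f p → (∀ n → p n ≡ oneS n + (f ⊛ p) n) → ∀ Q n → (p ⊛ Q) n ≡ (f ⊛ (p ⊛ Q)) n + Q n
⊛-fixpoint f p p≡1+fp Q n = begin
  (p ⊛ Q) n                              ≡⟨ ⊛-congˡ p≡1+fp Q n ⟩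
  ((λ i → oneS i + (f ⊛ p) i) ⊛ Q) n    ≡⟨ ⊛-distribʳ-+ oneS (f ⊛ p) Q n ⟩
  (oneS ⊛ Q) n + ((f ⊛ p) ⊛ Q) n         ≡⟨ cong₂ _+_ (⊛-identityˡ Q n) (⊛-assoc f p Q n) ⟩
  Q n + (f ⊛ (p ⊛ Q)) n                  ≡⟨ ℤP.+-comm (Q n) _ ⟩
  (f ⊛ (p ⊛ Q)) n + Q n                  ∎
  where open ≡-Reasoning

OrderAtLeast : ℕ → Series → Set
OrderAtLeast a f = ∀ i → i < a → f i ≡ 0ℤ

order-1 : ∀ {f} → f 0 ≡ 0ℤ → OrderAtLeast 1 f
order-1 f₀≡0 zero    _ = f₀≡0
order-1 f₀≡0 (suc i) (s≤s ())

⊛-order : ∀ {a b f g} → OrderAtLeast a f → OrderAtLeast b g → OrderAtLeast (a ℕ.+ b) (f ⊛ g)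
⊛-order {a} {b} {f} {g} ord-f ord-g n n<a+b = Σ≤-zero n term
  where
  term : ∀ i → i ≤ n → f i * g (n ∸ i) ≡ 0ℤ
  term i i≤n with i <? a
  ... | yes i<a = cong (_* g (n ∸ i)) (ord-f i i<a)
  ... | no  i≮a = trans (cong (f i *_) (ord-g (n ∸ i) n∸i<b)) (ℤP.*-zeroʳ (f i))
    where
    n∸i<b : n ∸ i < b
    n∸i<b = subst (n ∸ i <_) (ℕP.m+n∸m≡n i b)
      (ℕP.∸-monoˡ-< (ℕP.≤-trans n<a+b (ℕP.+-monoˡ-≤ b (ℕP.≮⇒≥ i≮a))) i≤n)

^S-order : ∀ {q} → OrderAtLeast 1 q → ∀ j → OrderAtLeast j (q ^S j)
^S-order ord-q zero    i ()
^S-order ord-q (suc j) = ⊛-order ord-q (^S-order ord-q j)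

⊛-leading : ∀ {a f} → OrderAtLeast a f → ∀ g → (f ⊛ g) a ≡ f a * g 0
⊛-leading {a} {f} ord-f g = trans
  (Σ≤-single a a _ ℕP.≤-refl (λ i i≤a i≢a → cong (_* g (a ∸ i)) (ord-f i (ℕP.≤∧≢⇒< i≤a i≢a))))
  (cong (λ m → f a * g m) (ℕP.n∸n≡0 a))

⊛-coefficient₁ : ∀ f g → f 0 ≡ 0ℤ → g 0 ≡ 1ℤ → (f ⊛ g) 1 ≡ f 1
⊛-coefficient₁ f g f₀≡0 g₀≡1 =
  trans (⊛-leading {1} {f} (order-1 f₀≡0) g) (trans (cong (f 1 *_) g₀≡1) (ℤP.*-identityʳ (f 1)))

⊛-cancelʳ : ∀ {f p} → p 0 ≡ 1ℤ → (∀ n → (f ⊛ p) n ≡ 0ℤ) → ∀ n → f n ≡ 0ℤ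
⊛-cancelʳ {f} {p} p₀≡1 fp≡0 n = order (suc n) n ℕP.≤-refl
  where
  open ≡-Reasoning
  order : ∀ a → OrderAtLeast a f
  order (suc a) i i<1+a with ℕP.m<1+n⇒m<n∨m≡n i<1+a
  ... | inj₁ i<a  = order a i i<a
  ... | inj₂ refl = begin
    f i       ≡⟨ sym (ℤP.*-identityʳ (f i)) ⟩
    f i * 1ℤ  ≡⟨ cong (f i *_) (sym p₀≡1) ⟩
    f i * p 0 ≡⟨ sym (⊛-leading (order i) p) ⟩
    (f ⊛ p) i ≡⟨ fp≡0 i ⟩
    0ℤ        ∎

-- The first-metatile recurrence

δ : ℕ → Series
δ zero    = oneS
δ (suc _) = λ _ → 0ℤ

Solves : (ℕ → Series) → (ℕ → Series) → Set
Solves C W = ∀ k n → W k n ≡ δ k n + Σ≤ k (λ s → (C s ⊛ W (k ∸ s)) n)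

module Recurrence (C : ℕ → Series) (C-const : ∀ s → C s 0 ≡ 0ℤ) where

  solution-unique : ∀ {W V} → Solves C W → Solves C V → ∀ k n → W k n ≡ V k n
  solution-unique {W} {V} solW solV k n = <-rec (λ n → ∀ k → W k n ≡ V k n) step n k
    where
    step : ∀ n → (∀ {m} → m < n → ∀ k → W k m ≡ V k m) → ∀ k → W k n ≡ V k n
    step n ih k = trans (solW k n) (trans (cong (λ t → δ k n + t)
      (Σ≤-cong k (λ s _ → Σ≤-cong n (term s (k ∸ s))))) (sym (solV k n)))
      where
      term : ∀ s j i → i ≤ n → C s i * W j (n ∸ i) ≡ C s i * V j (n ∸ i)
      term s j zero    _    =
        trans (cong (_* W j n) (C-const s)) (sym (cong (_* V j n) (C-const s)))
      term s j (suc i) i<n = cong (C s (suc i) *_) (ih (ℕP.∸-monoʳ-< (s≤s z≤n) i<n) j)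

  solution-const : ∀ {W} → Solves C W → W 0 0 ≡ 1ℤ
  solution-const {W} solW = trans (solW 0 0) (cong (λ c → 1ℤ + c * W 0 0) (C-const 0))

  module Necessity {W} (solW : Solves C W) {p q} (W≡pq : ∀ n k → W k n ≡ (p ⊛ (q ^S k)) n) where

    W₀≗p : W 0 ≗ p
    W₀≗p n = trans (W≡pq n 0) (⊛-identityʳ p n)

    p₀≡1 : p 0 ≡ 1ℤ
    p₀≡1 = trans (sym (W₀≗p 0)) (solution-const solW)

    p≡1+C₀p : ∀ n → p n ≡ oneS n + (C 0 ⊛ p) n
    p≡1+C₀p n = trans (sym (W₀≗p n))
      (trans (solW 0 n) (cong (λ t → oneS n + t) (⊛-congʳ (C 0) W₀≗p n)))

    tail-sum : ∀ k n → Σ≤ k (λ s → (C (suc s) ⊛ W (k ∸ s)) n) ≡ (q ^S suc k) n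
    tail-sum k n = ∙-cancelˡ ((C 0 ⊛ (p ⊛ Q)) n) _ _ (trans (sym split)
                     (⊛-fixpoint (C 0) p p≡1+C₀p Q n))
      where
      open ≡-Reasoning
      Q = q ^S suc k
      split : (p ⊛ Q) n ≡ (C 0 ⊛ (p ⊛ Q)) n + Σ≤ k (λ s → (C (suc s) ⊛ W (k ∸ s)) n)
      split = begin
        (p ⊛ Q) n                                            ≡⟨ sym (W≡pq n (suc k)) ⟩
        W (suc k) n                                          ≡⟨ solW (suc k) n ⟩
        0ℤ + Σ≤ (suc k) (λ s → (C s ⊛ W (suc k ∸ s)) n)      ≡⟨ ℤP.+-identityˡ _ ⟩
        Σ≤ (suc k) (λ s → (C s ⊛ W (suc k ∸ s)) n)           ≡⟨ Σ≤-head k _ ⟩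
        (C 0 ⊛ W (suc k)) n + Σ≤ k (λ s → (C (suc s) ⊛ W (k ∸ s)) n)
          ≡⟨ cong (_+ _) (⊛-congʳ (C 0) (λ m → W≡pq m (suc k)) n) ⟩
        (C 0 ⊛ (p ⊛ Q)) n + Σ≤ k (λ s → (C (suc s) ⊛ W (k ∸ s)) n) ∎

    C₁p≗q : C 1 ⊛ p ≗ q
    C₁p≗q n = trans (⊛-congʳ (C 1) (λ m → sym (W₀≗p m)) n)
                    (trans (tail-sum 0 n) (⊛-identityʳ q n))

    C₁₁≡q₁ : C 1 1 ≡ q 1
    C₁₁≡q₁ = trans (sym (⊛-coefficient₁ (C 1) p (C-const 1) p₀≡1)) (C₁p≗q 1)

    higher-sum-zero : ∀ j n → Σ≤ j (λ s → (C (suc (suc s)) ⊛ W (j ∸ s)) n) ≡ 0ℤ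
    higher-sum-zero j n = ∙-cancelˡ (Q n) _ _ (begin
      Q n + Higher                      ≡⟨ cong (_+ Higher) (sym first) ⟩
      (C 1 ⊛ W (suc j)) n + Higher      ≡⟨ sym split ⟩
      Q n                               ≡⟨ sym (ℤP.+-identityʳ (Q n)) ⟩
      Q n + 0ℤ                          ∎)
      where
      open ≡-Reasoning
      Higher : ℤ
      Higher = Σ≤ j (λ s → (C (suc (suc s)) ⊛ W (j ∸ s)) n)
      Q = q ^S (suc (suc j))
      first : (C 1 ⊛ W (suc j)) n ≡ Q n
      first = trans (⊛-congʳ (C 1) (λ m → W≡pq m (suc j)) n)
                (trans (sym (⊛-assoc (C 1) p (q ^S suc j) n)) (⊛-congˡ C₁p≗q (q ^S suc j) n))
      split : Q n ≡ (C 1 ⊛ W (suc j)) n + Higher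
      split = trans (sym (tail-sum (suc j) n)) (Σ≤-head j _)

    higher-vanish : ∀ j n → C (suc (suc j)) n ≡ 0ℤ
    higher-vanish = <-rec (λ j → ∀ n → C (suc (suc j)) n ≡ 0ℤ) step
      where
      step : ∀ j → (∀ {s} → s < j → ∀ n → C (suc (suc s)) n ≡ 0ℤ) → ∀ n → C (suc (suc j)) n ≡ 0ℤ
      step j ih = ⊛-cancelʳ {C (suc (suc j))} {p} p₀≡1 λ n → begin
        (C (suc (suc j)) ⊛ p) n
          ≡⟨ ⊛-congʳ (C (suc (suc j))) p≗W[j∸j] n ⟩
        (C (suc (suc j)) ⊛ W (j ∸ j)) n
          ≡⟨ sym (Σ≤-single j j _ ℕP.≤-refl (λ s s≤j s≢j →
               ⊛-zeroˡ (ih (ℕP.≤∧≢⇒< s≤j s≢j)) (W (j ∸ s)) n)) ⟩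
        Σ≤ j (λ s → (C (suc (suc s)) ⊛ W (j ∸ s)) n)
          ≡⟨ higher-sum-zero j n ⟩
        0ℤ ∎
        where
        open ≡-Reasoning
        p≗W[j∸j] : p ≗ W (j ∸ j)
        p≗W[j∸j] m = trans (sym (W₀≗p m)) (cong (λ i → W i m) (sym (ℕP.n∸n≡0 j)))

  module Sufficiency {W} (solW : Solves C W) (C≥2≡0 : ∀ j n → C (suc (suc j)) n ≡ 0ℤ) where

    q : Series
    q = C 1 ⊛ W 0

    powers-solve : Solves C (λ k → W 0 ⊛ (q ^S k))
    powers-solve zero n = trans (⊛-identityʳ (W 0) n)
      (trans (solW 0 n)
        (cong (λ t → oneS n + t) (⊛-congʳ (C 0) (λ m → sym (⊛-identityʳ (W 0) m)) n)))
    powers-solve (suc k) n = begin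
      (W 0 ⊛ Q) n
        ≡⟨ ⊛-fixpoint (C 0) (W 0) (solW 0) Q n ⟩
      (C 0 ⊛ (W 0 ⊛ Q)) n + Q n
        ≡⟨ cong (λ t → (C 0 ⊛ (W 0 ⊛ Q)) n + t)
                (trans (⊛-assoc (C 1) (W 0) (q ^S k) n) (sym only-C₁)) ⟩
      (C 0 ⊛ (W 0 ⊛ Q)) n + Σ≤ k (λ s → (C (suc s) ⊛ (W 0 ⊛ (q ^S (k ∸ s)))) n)
        ≡⟨ sym (Σ≤-head k _) ⟩
      Σ≤ (suc k) (λ s → (C s ⊛ (W 0 ⊛ (q ^S (suc k ∸ s)))) n)
        ≡⟨ sym (ℤP.+-identityˡ _) ⟩
      0ℤ + Σ≤ (suc k) (λ s → (C s ⊛ (W 0 ⊛ (q ^S (suc k ∸ s)))) n) ∎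
      where
      open ≡-Reasoning
      Q = q ^S suc k
      only-C₁ : Σ≤ k (λ s → (C (suc s) ⊛ (W 0 ⊛ (q ^S (k ∸ s)))) n) ≡ (C 1 ⊛ (W 0 ⊛ (q ^S k))) n
      only-C₁ = Σ≤-single k 0 _ z≤n off
        where
        off : ∀ s → s ≤ k → s ≢ 0 → (C (suc s) ⊛ (W 0 ⊛ (q ^S (k ∸ s)))) n ≡ 0ℤ
        off zero    _ s≢0 = ⊥-elim (s≢0 refl)
        off (suc s) _ _   = ⊛-zeroˡ (C≥2≡0 s) (W 0 ⊛ (q ^S (k ∸ suc s))) n

    riordan : C 1 1 ≢ 0ℤ → ∃₂ λ p q → RiordanPair p q × (∀ n k → W k n ≡ (p ⊛ (q ^S k)) n)
    riordan C₁₁≢0 = W 0 , q , (p₀≢0 , cong (_* W 0 0) (C-const 1) , q₁≢0) ,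
                    λ n k → solution-unique solW powers-solve k n
      where
      p₀≢0 : W 0 0 ≢ 0ℤ
      p₀≢0 p₀≡0 with trans (sym (solution-const solW)) p₀≡0
      ... | ()
      q₁≢0 : q 1 ≢ 0ℤ
      q₁≢0 q₁≡0 =
        C₁₁≢0 (trans (sym (⊛-coefficient₁ (C 1) (W 0) (C-const 1) (solution-const solW))) q₁≡0)

  riordan-solution⇔ : ∀ {W} → Solves C W →
    (∃₂ λ p q → RiordanPair p q × (∀ n k → W k n ≡ (p ⊛ (q ^S k)) n)) ⇔
    (C 1 1 ≢ 0ℤ × (∀ j n → C (suc (suc j)) n ≡ 0ℤ))
  riordan-solution⇔ solW = mk⇔
    (λ (p , q , (_ , _ , q₁≢0) , W≡pq) → let open Necessity solW {p} {q} W≡pq in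
      (λ C₁₁≡0 → q₁≢0 (trans (sym C₁₁≡q₁) C₁₁≡0)) , higher-vanish)
    (λ (C₁₁≢0 , C≥2≡0) → Sufficiency.riordan solW C≥2≡0 C₁₁≢0)

Σℕ≤ : ℕ → (ℕ → ℕ) → ℕ
Σℕ≤ zero    f = f 0
Σℕ≤ (suc n) f = Σℕ≤ n f ℕ.+ f (suc n)

Σℕ≤-cong : ∀ n {f g : ℕ → ℕ} → (∀ i → i ≤ n → f i ≡ g i) → Σℕ≤ n f ≡ Σℕ≤ n g
Σℕ≤-cong zero    f≡g = f≡g 0 z≤n
Σℕ≤-cong (suc n) f≡g =
  cong₂ ℕ._+_ (Σℕ≤-cong n (λ i i≤n → f≡g i (ℕP.m≤n⇒m≤1+n i≤n))) (f≡g (suc n) ℕP.≤-refl)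

Σℕ≤-zero : ∀ n {f : ℕ → ℕ} → (∀ i → i ≤ n → f i ≡ 0) → Σℕ≤ n f ≡ 0
Σℕ≤-zero zero    f≡0 = f≡0 0 z≤n
Σℕ≤-zero (suc n) f≡0 =
  cong₂ ℕ._+_ (Σℕ≤-zero n (λ i i≤n → f≡0 i (ℕP.m≤n⇒m≤1+n i≤n))) (f≡0 (suc n) ℕP.≤-refl)

Σℕ≤-head : ∀ n (f : ℕ → ℕ) → Σℕ≤ (suc n) f ≡ f 0 ℕ.+ Σℕ≤ n (λ i → f (suc i))
Σℕ≤-head zero    f = refl
Σℕ≤-head (suc n) f = trans (cong (ℕ._+ f (suc (suc n))) (Σℕ≤-head n f)) (ℕP.+-assoc (f 0) _ _)

Σℕ≤-≥ : ∀ n (f : ℕ → ℕ) i → i ≤ n → f i ≤ Σℕ≤ n f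
Σℕ≤-≥ zero    f zero z≤n = ℕP.≤-refl
Σℕ≤-≥ (suc n) f i i≤1+n with ℕP.m≤n⇒m<n∨m≡n i≤1+n
... | inj₁ i<1+n = ℕP.≤-trans (Σℕ≤-≥ n f i (ℕP.≤-pred i<1+n)) (ℕP.m≤m+n _ _)
... | inj₂ refl  = ℕP.m≤n+m _ _

+-Σℕ≤ : ∀ n (f : ℕ → ℕ) → + Σℕ≤ n f ≡ Σ≤ n (λ i → + f i)
+-Σℕ≤ zero    f = refl
+-Σℕ≤ (suc n) f = cong (_+ + f (suc n)) (+-Σℕ≤ n f)

sum-map-cong : ∀ L {f g : ℕ → ℕ} → (∀ x → x ∈ L → f x ≡ g x) → sum (map f L) ≡ sum (map g L)
sum-map-cong []       _   = refl
sum-map-cong (x ∷ xs) f≡g =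
  cong₂ ℕ._+_ (f≡g x (here refl)) (sum-map-cong xs (λ y y∈ → f≡g y (there y∈)))

sum-map-zero : ∀ L {f : ℕ → ℕ} → (∀ x → x ∈ L → f x ≡ 0) → sum (map f L) ≡ 0
sum-map-zero []       _   = refl
sum-map-zero (x ∷ xs) f≡0 =
  cong₂ ℕ._+_ (f≡0 x (here refl)) (sum-map-zero xs (λ y y∈ → f≡0 y (there y∈)))

sum-map-≥ : ∀ {L} (f : ℕ → ℕ) {x} → x ∈ L → f x ≤ sum (map f L)
sum-map-≥ f (here refl) = ℕP.m≤m+n _ _
sum-map-≥ f (there x∈)  = ℕP.≤-trans (sum-map-≥ f x∈) (ℕP.m≤n+m _ _)

viaFirstMetatile : Metatiles → ℕ → ℕ → (ℕ → ℕ) → ℕ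
viaFirstMetatile M k l r = sum (map (λ s → if s ≤ᵇ k then r (k ∸ s) else 0) (M l))

sumFrom : (ℕ → (ℕ → ℕ) → ℕ) → ℕ → List (ℕ → ℕ) → ℕ
sumFrom S l []       = 0
sumFrom S l (r ∷ rs) = S l r ℕ.+ sumFrom S (suc l) rs

sumFrom-unique : ∀ {S} {go : ℕ → List (ℕ → ℕ) → ℕ} →
  (∀ l → go l [] ≡ 0) → (∀ l r rs → go l (r ∷ rs) ≡ S l r ℕ.+ go (suc l) rs) →
  ∀ l rs → go l rs ≡ sumFrom S l rs
sumFrom-unique         go[]  go∷ l []       = go[] l
sumFrom-unique {S} {go} go[] go∷ l (r ∷ rs) =
  trans (go∷ l r rs) (cong (S l r ℕ.+_) (sumFrom-unique {S} {go} go[] go∷ (suc l) rs))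

-- The function `go` local to `row` cannot be named here. Generalising the list it
-- closes over and its length counter turns its occurrence into a pattern, so
-- that unification finds it as the `_` in the type of go≡sumFrom.
row-suc : ∀ M n k r rs → row M (suc n) (r ∷ rs) k ≡ sumFrom (viaFirstMetatile M k) 1 (r ∷ rs)
row-suc M n k = unfold
  where
  go≡sumFrom : ∀ prev l rs → _ ≡ sumFrom (viaFirstMetatile M k) l rs
  go≡sumFrom prev = sumFrom-unique (λ _ → refl) (λ _ _ _ → refl)
  unfold : ∀ r rs → row M (suc n) (r ∷ rs) k ≡ sumFrom (viaFirstMetatile M k) 1 (r ∷ rs)
  unfold r rs with r ∷ rs | 2
  ... | prev | l = cong (viaFirstMetatile M k 1 r ℕ.+_) (go≡sumFrom prev l rs)

sumFrom-table : ∀ M k m l → sumFrom (viaFirstMetatile M k) l (table M (suc m))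
                            ≡ Σℕ≤ m (λ i → viaFirstMetatile M k (l ℕ.+ i) (T M (m ∸ i)))
sumFrom-table M k zero l =
  trans (ℕP.+-identityʳ _) (cong (λ l′ → viaFirstMetatile M k l′ (T M 0)) (sym (ℕP.+-identityʳ l)))
sumFrom-table M k (suc m) l = trans
  (cong₂ ℕ._+_ (cong (λ l′ → viaFirstMetatile M k l′ (T M (suc m))) (sym (ℕP.+-identityʳ l)))
               (trans (sumFrom-table M k m (suc l))
                      (Σℕ≤-cong m (λ i _ → cong (λ l′ → viaFirstMetatile M k l′ (T M (m ∸ i)))
                                                (sym (ℕP.+-suc l i))))))
  (sym (Σℕ≤-head m (λ i → viaFirstMetatile M k (l ℕ.+ i) (T M (suc m ∸ i)))))

T-recurrence : ∀ M n k → T M (suc n) k ≡ Σℕ≤ n (λ i → viaFirstMetatile M k (suc i) (T M (n ∸ i)))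
T-recurrence M n k = trans (row-suc M n k (T M n) (table M n)) (sumFrom-table M k n 1)

-- The generating functions of a metatile set

count : ℕ → List ℕ → ℕ
count s []       = 0
count s (x ∷ xs) = if s ℕ.≡ᵇ x then suc (count s xs) else count s xs

≡ᵇ-reflects-≡ : ∀ m n → Reflects (m ≡ n) (m ℕ.≡ᵇ n)
≡ᵇ-reflects-≡ m n = proof (m ≟ n)

count≢0⇒∈ : ∀ {s} L → count s L ≢ 0 → s ∈ L
count≢0⇒∈     []       c≢0 = ⊥-elim (c≢0 refl)
count≢0⇒∈ {s} (x ∷ xs) c≢0 with s ℕ.≡ᵇ x | ≡ᵇ-reflects-≡ s x
... | true  | ofʸ s≡x = here s≡x
... | false | _       = there (count≢0⇒∈ xs c≢0)

∈⇒count≢0 : ∀ {s L} → s ∈ L → count s L ≢ 0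
∈⇒count≢0 {s} {x ∷ xs} s∈ with s ℕ.≡ᵇ x | ≡ᵇ-reflects-≡ s x | s∈
... | true  | _       | _          = λ ()
... | false | ofⁿ s≢x | here s≡x   = ⊥-elim (s≢x s≡x)
... | false | _       | there s∈xs = ∈⇒count≢0 s∈xs

∉⇒count≡0 : ∀ {s} L → s ∉ L → count s L ≡ 0
∉⇒count≡0     []       _   = refl
∉⇒count≡0 {s} (x ∷ xs) s∉ with s ℕ.≡ᵇ x | ≡ᵇ-reflects-≡ s x
... | true  | ofʸ s≡x = ⊥-elim (s∉ (here s≡x))
... | false | _       = ∉⇒count≡0 xs (λ s∈xs → s∉ (there s∈xs))

count-∷ : ∀ s x xs (g : ℤ) →
  + count s (x ∷ xs) * g ≡ (if s ℕ.≡ᵇ x then g else 0ℤ) + + count s xs * g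
count-∷ s x xs g with s ℕ.≡ᵇ x
... | true  =
  trans (ℤP.*-distribʳ-+ g 1ℤ (+ count s xs)) (cong (_+ + count s xs * g) (ℤP.*-identityˡ g))
... | false = sym (ℤP.+-identityˡ _)

Σ≤-indicator : ∀ k x (g : ℕ → ℤ) →
  Σ≤ k (λ s → if s ℕ.≡ᵇ x then g s else 0ℤ) ≡ (if x ≤ᵇ k then g x else 0ℤ)
Σ≤-indicator k x g with x ≤ᵇ k | ℕP.≤ᵇ-reflects-≤ x k
... | true  | ofʸ x≤k = trans
  (Σ≤-single k x _ x≤k (λ s _ s≢x → cong (if_then g s else 0ℤ) (dec-false (s ≟ x) s≢x)))
  (cong (if_then g x else 0ℤ) (dec-true (x ≟ x) refl))
... | false | ofⁿ x≰k =
  Σ≤-zero k (λ s s≤k → cong (if_then g s else 0ℤ) (dec-false (s ≟ x) (λ { refl → x≰k s≤k })))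

sum-by-count : ∀ k (r : ℕ → ℕ) L →
  + sum (map (λ s → if s ≤ᵇ k then r (k ∸ s) else 0) L) ≡ Σ≤ k (λ s → + count s L * + r (k ∸ s))
sum-by-count k r []       = sym (Σ≤-zero k (λ _ _ → refl))
sum-by-count k r (x ∷ xs) = begin
  + ((if x ≤ᵇ k then r (k ∸ x) else 0) ℕ.+ rest)
    ≡⟨ ℤP.pos-+ _ rest ⟩
  + (if x ≤ᵇ k then r (k ∸ x) else 0) + + rest
    ≡⟨ cong₂ _+_ (trans (if-float +_ (x ≤ᵇ k)) (sym (Σ≤-indicator k x g))) (sum-by-count k r xs) ⟩
  Σ≤ k (λ s → if s ℕ.≡ᵇ x then g s else 0ℤ) + Σ≤ k (λ s → + count s xs * g s)
    ≡⟨ sym (Σ≤-distrib-+ k _ _) ⟩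
  Σ≤ k (λ s → (if s ℕ.≡ᵇ x then g s else 0ℤ) + + count s xs * g s)
    ≡⟨ Σ≤-cong k (λ s _ → sym (count-∷ s x xs (g s))) ⟩
  Σ≤ k (λ s → + count s (x ∷ xs) * g s) ∎
  where
  open ≡-Reasoning
  rest = sum (map (λ s → if s ≤ᵇ k then r (k ∸ s) else 0) xs)
  g : ℕ → ℤ
  g s = + r (k ∸ s)

metatileGF : Metatiles → ℕ → Series
metatileGF M s l = + count s (M l)

columnGF : Metatiles → ℕ → Series
columnGF M k n = + T M n k

metatileGF-const : ∀ M → M 0 ≡ [] → ∀ s → metatileGF M s 0 ≡ 0ℤ
metatileGF-const M M₀≡[] s = cong (λ L → + count s L) M₀≡[]

T-solves : ∀ M → M 0 ≡ [] → Solves (metatileGF M) (columnGF M)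
T-solves M M₀≡[] k zero = trans (T₀ k)
  (cong (λ t → δ k 0 + t) (sym (Σ≤-zero k (λ s _ →
    cong (_* columnGF M (k ∸ s) 0) (metatileGF-const M M₀≡[] s)))))
  where
  T₀ : ∀ k → + T M 0 k ≡ δ k 0 + 0ℤ
  T₀ zero    = refl
  T₀ (suc k) = refl
T-solves M M₀≡[] k (suc n) = begin
  + T M (suc n) k
    ≡⟨ cong +_ (T-recurrence M n k) ⟩
  + Σℕ≤ n (λ i → viaFirstMetatile M k (suc i) (T M (n ∸ i)))
    ≡⟨ +-Σℕ≤ n _ ⟩
  Σ≤ n (λ i → + viaFirstMetatile M k (suc i) (T M (n ∸ i)))
    ≡⟨ Σ≤-cong n (λ i _ → sum-by-count k (T M (n ∸ i)) (M (suc i))) ⟩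
  Σ≤ n (λ i → Σ≤ k (λ s → metatileGF M s (suc i) * columnGF M (k ∸ s) (n ∸ i)))
    ≡⟨ Σ≤-swap n k _ ⟩
  Σ≤ k (λ s → Σ≤ n (λ i → metatileGF M s (suc i) * columnGF M (k ∸ s) (n ∸ i)))
    ≡⟨ Σ≤-cong k (λ s _ →
         sym (⊛-suc {metatileGF M s} (metatileGF-const M M₀≡[] s) (columnGF M (k ∸ s)) n)) ⟩
  Splits
    ≡⟨ sym (trans (cong (_+ Splits) (δ-suc k)) (ℤP.+-identityˡ Splits)) ⟩
  δ k (suc n) + Splits ∎
  where
  open ≡-Reasoning
  Splits : ℤ
  Splits = Σ≤ k (λ s → (metatileGF M s ⊛ columnGF M (k ∸ s)) (suc n))
  δ-suc : ∀ k → δ k (suc n) ≡ 0ℤ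
  δ-suc zero    = refl
  δ-suc (suc k) = refl

coefficients⇔CondI : ∀ M →
  (metatileGF M 1 1 ≢ 0ℤ × (∀ j l → metatileGF M (suc (suc j)) l ≡ 0ℤ)) ⇔ CondI M
coefficients⇔CondI M = mk⇔
  (λ (C₁₁≢0 , C≥2≡0) →
     count≢0⇒∈ (M 1) (λ c≡0 → C₁₁≢0 (cong +_ c≡0)) ,
     λ { l zero          _  → z≤n
       ; l (suc zero)    _  → ℕP.≤-refl
       ; l (suc (suc j)) s∈ → ⊥-elim (∈⇒count≢0 s∈ (ℤP.+-injective (C≥2≡0 j l))) })
  (λ (1∈ , ≤1) →
     (λ C₁₁≡0 → ∈⇒count≢0 1∈ (ℤP.+-injective C₁₁≡0)) ,
     λ j l → cong +_ (∉⇒count≡0 (M l) (λ s∈ → ℕP.<-irrefl refl (ℕP.≤-trans (≤1 l _ s∈) (s≤s z≤n)))))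

riordan⇔CondI : ∀ M → M 0 ≡ [] → IsRiordan (T M) ⇔ CondI M
riordan⇔CondI M M₀≡[] = coefficients⇔CondI M ⇔-∘
  Recurrence.riordan-solution⇔ (metatileGF M) (metatileGF-const M M₀≡[]) (T-solves M M₀≡[])

-- Part (ii): exchanging special and ordinary cells

reflect : Metatiles → Metatiles
reflect M l = map (l ∸_) (M l)

SpecialsBounded : Metatiles → Set
SpecialsBounded M = ∀ l s → s ∈ M l → s ≤ l

reflect-bounded : ∀ M → SpecialsBounded (reflect M)
reflect-bounded M l s s∈ with ∈-map⁻ (l ∸_) s∈
... | x , _ , refl = ℕP.m∸n≤m l x

∸-balance : ∀ {x d j k N} → x ≤ k → d ≤ j → d ℕ.+ x ℕ.+ N ≡ j ℕ.+ k → (j ∸ d) ℕ.+ (k ∸ x) ≡ N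
∸-balance {x} {d} {j} {k} {N} x≤k d≤j eq = ℕP.+-cancelʳ-≡ (d ℕ.+ x) _ N (begin
  (j ∸ d) ℕ.+ (k ∸ x) ℕ.+ (d ℕ.+ x)   ≡⟨ regroup (j ∸ d) (k ∸ x) d x ⟩
  (j ∸ d ℕ.+ d) ℕ.+ (k ∸ x ℕ.+ x)     ≡⟨ cong₂ ℕ._+_ (ℕP.m∸n+n≡m d≤j) (ℕP.m∸n+n≡m x≤k) ⟩
  j ℕ.+ k                             ≡⟨ sym eq ⟩
  d ℕ.+ x ℕ.+ N                       ≡⟨ ℕP.+-comm (d ℕ.+ x) N ⟩
  N ℕ.+ (d ℕ.+ x)                     ∎)
  where
  open ≡-Reasoning
  regroup : ∀ a b d x → a ℕ.+ b ℕ.+ (d ℕ.+ x) ≡ (a ℕ.+ d) ℕ.+ (b ℕ.+ x)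
  regroup = solve-∀

∸-gap : ∀ {x d j k N} → x ≤ k → j < d → d ℕ.+ x ℕ.+ N ≡ j ℕ.+ k → N < k ∸ x
∸-gap {x} {d} {j} {k} {N} x≤k j<d eq =
  ℕP.+-cancelˡ-< d N (k ∸ x) (subst (ℕ._< d ℕ.+ (k ∸ x)) (sym d+N≡j+b) (ℕP.+-monoˡ-< (k ∸ x) j<d))
  where
  move : ∀ d x N → d ℕ.+ x ℕ.+ N ≡ (d ℕ.+ N) ℕ.+ x
  move = solve-∀
  d+N≡j+b : d ℕ.+ N ≡ j ℕ.+ (k ∸ x)
  d+N≡j+b = ℕP.+-cancelʳ-≡ x _ _ (trans (sym (move d x N)) (trans eq
    (trans (cong (j ℕ.+_) (sym (ℕP.m∸n+n≡m x≤k))) (sym (ℕP.+-assoc j (k ∸ x) x)))))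

-- The contribution of a first metatile with x special and d ordinary cells, the
-- rest of the board having N cells, to T and to the reflected count.
mirror-term : ∀ {N x d j k} {A B : ℕ → ℕ} →
  (∀ a b → a ℕ.+ b ≡ N → A b ≡ B a) → (∀ b → N < b → A b ≡ 0) → (∀ a → N < a → B a ≡ 0) →
  d ℕ.+ x ℕ.+ N ≡ j ℕ.+ k →
  (if x ≤ᵇ k then A (k ∸ x) else 0) ≡ (if d ≤ᵇ j then B (j ∸ d) else 0)
mirror-term {N} {x} {d} {j} {k} mirror A-vanishes B-vanishes eq
  with x ≤ᵇ k | ℕP.≤ᵇ-reflects-≤ x k | d ≤ᵇ j | ℕP.≤ᵇ-reflects-≤ d j
... | true  | ofʸ x≤k | true  | ofʸ d≤j = mirror (j ∸ d) (k ∸ x) (∸-balance x≤k d≤j eq)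
... | true  | ofʸ x≤k | false | ofⁿ d≰j = A-vanishes (k ∸ x) (∸-gap x≤k (ℕP.≰⇒> d≰j) eq)
... | false | ofⁿ x≰k | true  | ofʸ d≤j = sym (B-vanishes (j ∸ d) (∸-gap d≤j (ℕP.≰⇒> x≰k) eq′))
  where
  eq′ : x ℕ.+ d ℕ.+ N ≡ k ℕ.+ j
  eq′ = trans (cong (ℕ._+ N) (ℕP.+-comm x d)) (trans eq (ℕP.+-comm j k))
... | false | _       | false | _       = refl

T-vanishes : ∀ {M} → SpecialsBounded M → ∀ n k → n < k → T M n k ≡ 0
T-vanishes {M} bounded = <-rec (λ n → ∀ k → n < k → T M n k ≡ 0) step
  where
  step : ∀ n → (∀ {m} → m < n → ∀ k → m < k → T M m k ≡ 0) → ∀ k → n < k → T M n k ≡ 0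
  step zero    _  (suc k) _     = refl
  step (suc n) ih k       1+n<k = trans (T-recurrence M n k) (Σℕ≤-zero n term)
    where
    term : ∀ i → i ≤ n → viaFirstMetatile M k (suc i) (T M (n ∸ i)) ≡ 0
    term i i≤n = sum-map-zero (M (suc i)) beyond
      where
      beyond : ∀ x → x ∈ M (suc i) → (if x ≤ᵇ k then T M (n ∸ i) (k ∸ x) else 0) ≡ 0
      beyond x x∈ with x ≤ᵇ k
      ... | false = refl
      ... | true  = ih (s≤s (ℕP.m∸n≤m n i)) (k ∸ x)
        (subst (_< k ∸ x) (ℕP.m+n∸n≡m (n ∸ i) x) (ℕP.∸-monoˡ-< N+x<k (ℕP.m≤n+m x (n ∸ i))))
        where
        N+x<k : n ∸ i ℕ.+ x < k
        N+x<k = ℕP.≤-<-trans (ℕP.+-monoʳ-≤ (n ∸ i) (bounded (suc i) x x∈))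
          (subst (_< k) (sym (trans (ℕP.+-suc (n ∸ i) i) (cong suc (ℕP.m∸n+n≡m i≤n)))) 1+n<k)

T-reflect : ∀ {M} → SpecialsBounded M → ∀ n j k → j ℕ.+ k ≡ n → T M n k ≡ T (reflect M) n j
T-reflect {M} bounded = <-rec P step
  where
  P : ℕ → Set
  P n = ∀ j k → j ℕ.+ k ≡ n → T M n k ≡ T (reflect M) n j
  step : ∀ n → (∀ {m} → m < n → P m) → P n
  step zero    _  zero    zero    _     = refl
  step zero    _  zero    (suc k) ()
  step zero    _  (suc j) k       ()
  step (suc n) ih j       k       j+k≡1+n = trans (T-recurrence M n k)
    (trans (Σℕ≤-cong n term) (sym (T-recurrence (reflect M) n j)))
    where
    term : ∀ i → i ≤ n → viaFirstMetatile M k (suc i) (T M (n ∸ i))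
                         ≡ viaFirstMetatile (reflect M) j (suc i) (T (reflect M) (n ∸ i))
    term i i≤n = trans
      (sum-map-cong (M (suc i)) (λ x x∈ → mirror-term {n ∸ i} {x} {suc i ∸ x} {j} {k}
        (ih N<1+n) (T-vanishes bounded (n ∸ i)) (T-vanishes (reflect-bounded M) (n ∸ i))
        (lengths (bounded (suc i) x x∈))))
      (cong sum (map-∘ (M (suc i))))
      where
      N<1+n : n ∸ i < suc n
      N<1+n = s≤s (ℕP.m∸n≤m n i)
      lengths : ∀ {x} → x ≤ suc i → (suc i ∸ x) ℕ.+ x ℕ.+ (n ∸ i) ≡ j ℕ.+ k
      lengths x≤1+i = trans (cong (ℕ._+ (n ∸ i)) (ℕP.m∸n+n≡m x≤1+i))
                            (trans (cong suc (ℕP.m+[n∸m]≡n i≤n)) (sym j+k≡1+n))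

metatile-tiles : ∀ {M l s} → s ∈ M (suc l) → 0 < T M (suc l) s
metatile-tiles {M} {l} {s} s∈ = begin-strict
  0                                                       <⟨ s≤s z≤n ⟩
  1                                                       ≤⟨ lone-metatile ⟩
  (if s ≤ᵇ s then T M (l ∸ l) (s ∸ s) else 0)             ≤⟨ sum-map-≥ _ s∈ ⟩
  viaFirstMetatile M s (suc l) (T M (l ∸ l))              ≤⟨ Σℕ≤-≥ l _ l ℕP.≤-refl ⟩
  Σℕ≤ l (λ i → viaFirstMetatile M s (suc i) (T M (l ∸ i))) ≡⟨ sym (T-recurrence M l s) ⟩
  T M (suc l) s                                           ∎
  where
  open ℕP.≤-Reasoning
  lone-metatile : 1 ≤ (if s ≤ᵇ s then T M (l ∸ l) (s ∸ s) else 0)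
  lone-metatile with s ≤ᵇ s | ℕP.≤ᵇ-reflects-≤ s s
  ... | true  | _      rewrite ℕP.n∸n≡0 l | ℕP.n∸n≡0 s = ℕP.≤-refl
  ... | false | ofⁿ s≰s = ⊥-elim (s≰s ℕP.≤-refl)

vanishing⇒bounded : ∀ {M} → M 0 ≡ [] → (∀ n k → n < k → T M n k ≡ 0) → SpecialsBounded M
vanishing⇒bounded M₀≡[] vanish zero    s s∈ = ⊥-elim (¬Any[] (subst (s ∈_) M₀≡[] s∈))
vanishing⇒bounded {M} M₀≡[] vanish (suc l) s s∈ with s ≤? suc l
... | yes s≤1+l = s≤1+l
... | no  s≰1+l = ⊥-elim (ℕP.<-irrefl refl
  (subst (0 <_) (vanish (suc l) s (ℕP.≰⇒> s≰1+l)) (metatile-tiles {M} s∈)))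

rowReversed⇔reflectRiordan : ∀ M → M 0 ≡ [] →
  IsRowReversedRiordan (T M) ⇔ (SpecialsBounded M × IsRiordan (T (reflect M)))
rowReversed⇔reflectRiordan M M₀≡[] = mk⇔
  (λ (p , q , pair@(_ , q₀≡0 , _) , lower , upper) → let bounded = vanishing⇒bounded M₀≡[] upper in
    bounded , p , q , pair , λ n j → reflected p q q₀≡0 bounded lower n j)
  (λ (bounded , p , q , pair , h) → p , q , pair ,
    (λ n k k≤n → trans (cong +_ (T-reflect bounded n (n ∸ k) k (ℕP.m∸n+n≡m k≤n))) (h n (n ∸ k))) ,
    T-vanishes bounded)
  where
  reflected : ∀ p q → q 0 ≡ 0ℤ → SpecialsBounded M →
    (∀ n k → k ≤ n → + T M n k ≡ (p ⊛ (q ^S (n ∸ k))) n) →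
    ∀ n j → + T (reflect M) n j ≡ (p ⊛ (q ^S j)) n
  reflected p q q₀≡0 bounded lower n j with j ≤? n
  ... | yes j≤n = trans (cong +_ (sym (T-reflect bounded n j (n ∸ j) (ℕP.m+[n∸m]≡n j≤n))))
    (trans (lower n (n ∸ j) (ℕP.m∸n≤m n j)) (cong (λ i → (p ⊛ (q ^S i)) n) (ℕP.m∸[m∸n]≡n j≤n)))
  ... | no  j≰n = trans (cong +_ (T-vanishes (reflect-bounded M) n j (ℕP.≰⇒> j≰n)))
    (sym (⊛-order {0} {j} {p} {q ^S j} (λ _ ()) (^S-order {q} (order-1 q₀≡0) j) n (ℕP.≰⇒> j≰n)))

reflect-CondI⇔CondII : ∀ M → (SpecialsBounded M × CondI (reflect M)) ⇔ CondII M
reflect-CondI⇔CondII M = mk⇔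
  (λ (bounded , 1∈ , ≤1) → ordinary-cell 1∈ , λ l s s∈ →
     length-shape (bounded l s s∈) (≤1 l (l ∸ s) (∈-map⁺ (l ∸_) s∈)))
  (λ (0∈ , shape) →
     (λ l s s∈ → shape-bounded (shape l s s∈)) ,
     ∈-map⁺ (1 ∸_) 0∈ ,
     λ l s s∈ → reflected-≤1 shape l s∈)
  where
  ordinary-cell : 1 ∈ map (1 ∸_) (M 1) → 0 ∈ M 1
  ordinary-cell 1∈ with ∈-map⁻ (1 ∸_) 1∈
  ... | zero          , x∈ , _  = x∈
  ... | suc zero      , _  , ()
  ... | suc (suc _)   , _  , ()
  length-shape : ∀ {l s} → s ≤ l → l ∸ s ≤ 1 → l ≡ s ⊎ l ≡ suc s
  length-shape {l} {s} s≤l l∸s≤1 with l ∸ s | ℕP.m∸n+n≡m s≤l | l∸s≤1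
  ... | zero        | d+s≡l | _          = inj₁ (sym d+s≡l)
  ... | suc zero    | d+s≡l | _          = inj₂ (sym d+s≡l)
  ... | suc (suc _) | _     | s≤s ()
  shape-bounded : ∀ {l s} → l ≡ s ⊎ l ≡ suc s → s ≤ l
  shape-bounded (inj₁ refl) = ℕP.≤-refl
  shape-bounded {s = s} (inj₂ refl) = ℕP.n≤1+n s
  reflected-≤1 : (∀ l s → s ∈ M l → l ≡ s ⊎ l ≡ suc s) → ∀ l {s} → s ∈ map (l ∸_) (M l) → s ≤ 1
  reflected-≤1 shape l s∈ with ∈-map⁻ (l ∸_) s∈
  ... | x , x∈ , refl with shape l x x∈
  ... | inj₁ refl = ℕP.≤-trans (ℕP.≤-reflexive (ℕP.n∸n≡0 x)) z≤n
  ... | inj₂ refl = ℕP.≤-reflexive (ℕP.m+n∸n≡m 1 x)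

theorem33 : (M : Metatiles) → M 0 ≡ [] →
    (IsRiordan (T M) ⇔ CondI M) × (IsRowReversedRiordan (T M) ⇔ CondII M)
theorem33 M M₀≡[] = riordan⇔CondI M M₀≡[] , (begin
  IsRowReversedRiordan (T M)
    ∼⟨ rowReversed⇔reflectRiordan M M₀≡[] ⟩
  (SpecialsBounded M × IsRiordan (T (reflect M)))
    ∼⟨ ⇔-id _ ×-⇔ riordan⇔CondI (reflect M) (cong (map (0 ∸_)) M₀≡[]) ⟩
  (SpecialsBounded M × CondI (reflect M))
    ∼⟨ reflect-CondI⇔CondII M ⟩
  CondII M ∎)
  where open EquationalReasoning
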